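{- Let $k$ be a positive integer, let $a\ge k+2$ and $G=K_a\,\Box\,K_a$. Then $\gamma_{P,k}(G/e)=a-k-1$ for every edge $e$ of $G$.
   Context: $K_a$ is the complete graph on $a$ vertices and $\Box$ denotes the Cartesian product: $V(G\Box H)=V(G)\times V(H)$, with $(g,h)$ adjacent to $(g',h')$ iff either $g=g'$ and $hh'\in E(H)$, or $h=h'$ and $gg'\in E(G)$. For an edge $e=xy$, the contraction $G/e$ is obtained from $G-e$ by replacing $x$ and $y$ by a single new vertex adjacent to all vertices (other than $x,y$) adjacent to $x$ or $y$. $N_G[v]$ is the closed neighbourhood of $v$ and $N_G[S]=\bigcup_{v\in S}N_G[v]$. For $S\subseteq V(G)$, define $\mathcal{P}^{0}_{G,k}(S)=N_G[S]$ and $\mathcal{P}^{t+1}_{G,k}(S)=\bigcup\{N_G[u] : u\in \mathcal{P}^{t}_{G,k}(S),\ |N_G[u]\setminus \mathcal{P}^{t}_{G,k}(S)|\le k\}$; these sets increase and stabilize to $\mathcal{P}^{\infty}_{G,k}(S)$. $S$ is a $k$-power dominating set if $\mathcal{P}^{\infty}_{G,k}(S)=V(G)$; $\gamma_{P,k}(G)$ is the minimum size of such a set. -}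

module Defs where

open import Data.Bool using (Bool; true; false; _∧_; _∨_; not; if_then_else_)
open import Data.Nat using (ℕ; zero; suc; pred; _*_; _≤ᵇ_; _≤_)
open import Data.Fin using (Fin; zero; suc; punchOut; remQuot; _≟_)
open import Data.Fin.Subset using (Subset; _∈_; _─_; ∣_∣)
open import Data.Vec using (tabulate; lookup)
open import Data.Product using (Σ; ∃; _×_; _,_; proj₁; proj₂)
open import Relation.Nullary using (yes; no; ¬_)
open import Relation.Nullary.Decidable using (⌊_⌋)
open import Relation.Binary.PropositionalEquality using (_≡_; _≢_; ≢-sym)

Graph : ℕ → Set
Graph n = Fin n → Fin n → Bool

anyFin : ∀ {n} → (Fin n → Bool) → Bool
anyFin {zero}  f = false
anyFin {suc n} f = f zero ∨ anyFin (λ i → f (suc i))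

_==_ : ∀ {n} → Fin n → Fin n → Bool
i == j = ⌊ i ≟ j ⌋

-- The graph K_a □ K_a, vertex (i , j) encoded in Fin (a * a) via remQuot.

KaBoxKa : (a : ℕ) → Graph (a * a)
KaBoxKa a u w =
  let (i  , j ) = remQuot {a} a u
      (i' , j') = remQuot {a} a w
  in ((i == i') ∧ not (j == j')) ∨ ((j == j') ∧ not (i == i'))

-- Vertex y is deleted
-- (remaining vertices renumbered by punchOut y) and identified with x.
-- punchOut {i = y} {j = v} is the index of v after removing y.

mergeMap : ∀ {m} (x y : Fin (suc m)) → x ≢ y → Fin (suc m) → Fin m
mergeMap x y x≢y v with v ≟ y
... | yes _   = punchOut {i = y} {j = x} (≢-sym x≢y)
... | no v≢y  = punchOut {i = y} {j = v} (≢-sym v≢y)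

contract : ∀ {n} (G : Graph n) (x y : Fin n) → x ≢ y → Graph (pred n)
contract {suc m} G x y x≢y u w =
  not (u == w) ∧
  anyFin (λ u' → anyFin (λ w' →
    (mergeMap x y x≢y u' == u) ∧ (mergeMap x y x≢y w' == w) ∧ G u' w'))

N[_∶_] : ∀ {n} → Graph n → Fin n → Subset n
N[ G ∶ u ] = tabulate (λ v → (u == v) ∨ G u v)

NS[_∶_] : ∀ {n} → Graph n → Subset n → Subset n
NS[ G ∶ S ] = tabulate (λ v → anyFin (λ u → lookup S u ∧ lookup N[ G ∶ u ] v))

propStep : ∀ {n} → ℕ → Graph n → Subset n → Subset n
propStep k G P = tabulate (λ v → anyFin (λ u →
  lookup P u ∧ (∣ N[ G ∶ u ] ─ P ∣ ≤ᵇ k) ∧ lookup N[ G ∶ u ] v))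

P[_,_]^_ : ∀ {n} → Graph n → ℕ → Subset n → ℕ → Subset n
(P[ G , k ]^ S) zero    = NS[ G ∶ S ]
(P[ G , k ]^ S) (suc t) = propStep k G ((P[ G , k ]^ S) t)

IsKPowerDom : ∀ {n} → ℕ → Graph n → Subset n → Set
IsKPowerDom k G S = ∀ v → ∃ λ t → v ∈ (P[ G , k ]^ S) t

γPk≡ : ∀ {n} → ℕ → Graph n → ℕ → Set
γPk≡ k G m =
  (Σ (Subset _) λ S → IsKPowerDom k G S × ∣ S ∣ ≡ m) ×
  (∀ S → IsKPowerDom k G S → m ≤ ∣ S ∣)

-- Write a = d + k + 2, give the vertices of K_a □ K_a coordinates (row, column), and assume
-- (after transposing) that the contracted edge xy lies in a column; x and y merge into z.
--
-- Upper bound: let S₀ consist of z and the vertices of the column of x in d chosen rows other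
-- than those of x and y.  Then N[S₀] contains the rows of x and y, the chosen rows and that
-- column, so every vertex in the row of x misses exactly the k vertices of its column lying in
-- the remaining rows, and one propagation step observes the whole graph.
--
-- Lower bound: for |S| ≤ d call a vertex of G free if neither its row nor its column meets the
-- preimage of S, and a vertex of G/e hidden if all its preimages are free.  Hidden vertices are
-- never observed.  They avoid N[S]; and if an observed u had a hidden neighbour, the line joining
-- the corresponding preimages would carry k + 1 free vertices with distinct hidden images,
-- all unobserved neighbours of u, because S occupies at most d columns and d + 1 rows (and only
-- d rows when it avoids the column of x, i.e. z ∉ S).  Counting free rows and columns shows that
-- a hidden vertex exists.

module Submission where

open import Defs
open import Data.Nat using (ℕ; _+_; _∸_; _*_; _≤_)
open import Data.Bool using (true)
open import Data.Fin using (Fin)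
open import Relation.Binary.PropositionalEquality using (_≡_; _≢_)

open import Data.Bool using (Bool; T; not; _∧_; _∨_)
open import Data.Bool.Properties using (T-≡; T-∨; T-∧)
open import Data.Empty using (⊥-elim)
open import Data.Fin using (zero; suc; fromℕ<; punchIn; punchOut; _≟_; _↑ˡ_; _↑ʳ_; splitAt; remQuot; combine)
open import Data.Fin.Properties
  using (injective⇒≤; suc-injective; any?; punchInᵢ≢i; punchIn-punchOut; punchOut-punchIn;
         punchIn-injective; punchOut-injective; punchOut-cong; splitAt⁻¹-↑ˡ; splitAt⁻¹-↑ʳ; ↑ˡ-injective;
         remQuot-combine; combine-remQuot)
open import Data.Fin.Subset using (Subset; inside; outside; _∈_; _∉_; _⊆_; _─_; _-_; ∁; ⊤; ⁅_⁆; ∣_∣; Nonempty)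
open import Data.Fin.Subset.Properties
  using (_∈?_; ∈⊤; x∈⁅x⁆; x∈∁p⇒x∉p; ∣⊤∣≡n; ∣∁p∣≡n∸∣p∣; p─q⊆p; x∈p∧x∉q⇒x∈p─q; x∈p∧x≢y⇒x∈p-y)
open import Data.Nat using (suc; zero; s≤s; z≤n; _<_; _≤ᵇ_)
open import Data.Nat.Properties
  using (≤-reflexive; ≤-trans; ≤-antisym; ≤-pred; +-monoʳ-≤; <⇒≱; ≮⇒≥; ≤ᵇ⇒≤; ≤⇒≤ᵇ;
         +-suc; +-comm; m+n∸n≡m; m+n≤o⇒m≤o∸n; m≤n⇒∃[o]m+o≡n)
open import Data.Product using (∃; ∃₂; _×_; _,_; proj₁; proj₂; uncurry)
import Data.Product as Product
open import Data.Sum using (_⊎_; inj₁; inj₂)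
import Data.Sum as Sum
open import Data.Vec using (_∷_; lookup; tabulate; here; there)
open import Data.Vec.Properties using (lookup∘tabulate; []=⇒lookup; lookup⇒[]=)
open import Function using (_∘_; id; _⇔_; mk⇔; case_of_)
open import Function.Bundles using (module Equivalence)
open import Relation.Binary.PropositionalEquality
  using (refl; sym; trans; cong; cong₂; subst; module ≡-Reasoning)
open import Relation.Nullary using (yes; no; ¬_)
open import Relation.Nullary.Decidable
  using (⌊_⌋; toSum; toWitness; fromWitness; fromWitnessFalse; _×-dec_)
open import Relation.Unary using (Decidable)

open Equivalence using (to; from)

private
  variable
    n n′ : ℕ

-- Counting members of subsets

enum : (p : Subset n) → Fin ∣ p ∣ → Fin n
enum (inside ∷ p)  zero    = zero
enum (inside ∷ p)  (suc i) = suc (enum p i)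
enum (outside ∷ p) i       = suc (enum p i)

enum-∈ : (p : Subset n) (i : Fin ∣ p ∣) → enum p i ∈ p
enum-∈ (inside ∷ p)  zero    = here
enum-∈ (inside ∷ p)  (suc i) = there (enum-∈ p i)
enum-∈ (outside ∷ p) i       = there (enum-∈ p i)

index : {p : Subset n} {x : Fin n} → x ∈ p → Fin ∣ p ∣
index {p = inside ∷ p}  here        = zero
index {p = inside ∷ p}  (there x∈p) = suc (index x∈p)
index {p = outside ∷ p} (there x∈p) = index x∈p

enum-index : {p : Subset n} {x : Fin n} (x∈p : x ∈ p) → enum p (index x∈p) ≡ x
enum-index {p = inside ∷ p}  here        = refl
enum-index {p = inside ∷ p}  (there x∈p) = cong suc (enum-index x∈p)
enum-index {p = outside ∷ p} (there x∈p) = cong suc (enum-index x∈p)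

index-injective : {p : Subset n} {x y : Fin n} (x∈p : x ∈ p) (y∈p : y ∈ p) →
                  index x∈p ≡ index y∈p → x ≡ y
index-injective x∈p y∈p eq =
  trans (sym (enum-index x∈p)) (trans (cong (enum _) eq) (enum-index y∈p))

enum-injective : (p : Subset n) {i j : Fin ∣ p ∣} → enum p i ≡ enum p j → i ≡ j
enum-injective (inside ∷ p)  {zero}  {zero}  _  = refl
enum-injective (inside ∷ p)  {suc i} {suc j} eq = cong suc (enum-injective p (suc-injective eq))
enum-injective (outside ∷ p)                 eq = enum-injective p (suc-injective eq)

injectiveOn⇒∣p∣≤∣q∣ : {p : Subset n} {q : Subset n′} (h : Fin n → Fin n′) →
  (∀ {i} → i ∈ p → h i ∈ q) →
  (∀ {i j} → i ∈ p → j ∈ p → h i ≡ h j → i ≡ j) →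
  ∣ p ∣ ≤ ∣ q ∣
injectiveOn⇒∣p∣≤∣q∣ {p = p} h into inj = injective⇒≤ λ {s} {t} eq →
  enum-injective p (inj (enum-∈ p s) (enum-∈ p t) (index-injective (into (enum-∈ p s)) (into (enum-∈ p t)) eq))

surjectiveOn⇒∣q∣≤∣p∣ : {p : Subset n} {q : Subset n′} (h : Fin n → Fin n′) →
  (∀ {j} → j ∈ q → ∃ λ i → i ∈ p × h i ≡ j) →
  ∣ q ∣ ≤ ∣ p ∣
surjectiveOn⇒∣q∣≤∣p∣ {p = p} {q} h onto =
  injective⇒≤ {f = λ t → index (pre-∈ t)} λ {s} {t} eq →
    enum-injective q (begin
      enum q s   ≡⟨ sym (h-pre s) ⟩
      h (pre s)  ≡⟨ cong h (index-injective (pre-∈ s) (pre-∈ t) eq) ⟩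
      h (pre t)  ≡⟨ h-pre t ⟩
      enum q t   ∎)
  where
  open ≡-Reasoning

  pre : Fin ∣ q ∣ → Fin _
  pre t = proj₁ (onto (enum-∈ q t))

  pre-∈ : ∀ t → pre t ∈ p
  pre-∈ t = proj₁ (proj₂ (onto (enum-∈ q t)))

  h-pre : ∀ t → h (pre t) ≡ enum q t
  h-pre t = proj₂ (proj₂ (onto (enum-∈ q t)))

∣p∣≤1+∣p-x∣ : (p : Subset n) (x : Fin n) → ∣ p ∣ ≤ suc ∣ p - x ∣
∣p∣≤1+∣p-x∣ {n} p x = surjectiveOn⇒∣q∣≤∣p∣ {p = inside ∷ (p - x)} h onto
  where
  h : Fin (suc n) → Fin n
  h zero    = x
  h (suc i) = i

  onto : ∀ {j} → j ∈ p → ∃ λ i → i ∈ inside ∷ (p - x) × h i ≡ j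
  onto {j} j∈p with j ≟ x
  ... | yes refl = zero , here , refl
  ... | no j≢x   = suc j , there (x∈p∧x≢y⇒x∈p-y j∈p j≢x) , refl

m+∣p∣≤n⇒m≤∣∁p∣ : ∀ {m} (p : Subset n) → m + ∣ p ∣ ≤ n → m ≤ ∣ ∁ p ∣
m+∣p∣≤n⇒m≤∣∁p∣ {m = m} p le = subst (m ≤_) (sym (∣∁p∣≡n∸∣p∣ p)) (m+n≤o⇒m≤o∸n m le)

x∈p─q⇒x∉q : {x : Fin n} (p q : Subset n) → x ∈ p ─ q → x ∉ q
x∈p─q⇒x∉q (inside ∷ p) (outside ∷ q) here        ()
x∈p─q⇒x∉q (_ ∷ p)      (_ ∷ q)       (there x∈r) (there x∈q) = x∈p─q⇒x∉q p q x∈r x∈q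

∣p∣>0⇒Nonempty : (p : Subset n) → 0 < ∣ p ∣ → Nonempty p
∣p∣>0⇒Nonempty p 0<∣p∣ = enum p (fromℕ< 0<∣p∣) , enum-∈ p (fromℕ< 0<∣p∣)

x∈p-y⇒x≢y : {p : Subset n} {x y : Fin n} → x ∈ p - y → x ≢ y
x∈p-y⇒x≢y {p = p} {y = y} x∈ refl = x∈p─q⇒x∉q p ⁅ y ⁆ x∈ (x∈⁅x⁆ y)

∈-tabulate⁺ : {f : Fin n → Bool} {i : Fin n} → T (f i) → i ∈ tabulate f
∈-tabulate⁺ {f = f} {i} t = lookup⇒[]= i (tabulate f) (trans (lookup∘tabulate f i) (to T-≡ t))

∈-tabulate⁻ : {f : Fin n → Bool} {i : Fin n} → i ∈ tabulate f → T (f i)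
∈-tabulate⁻ {f = f} {i} i∈ = from T-≡ (trans (sym (lookup∘tabulate f i)) ([]=⇒lookup i∈))

T-lookup⇒∈ : {p : Subset n} {i : Fin n} → T (lookup p i) → i ∈ p
T-lookup⇒∈ {p = p} {i} t = lookup⇒[]= i p (to T-≡ t)

∈⇒T-lookup : {p : Subset n} {i : Fin n} → i ∈ p → T (lookup p i)
∈⇒T-lookup i∈ = from T-≡ ([]=⇒lookup i∈)

T-anyFin⁺ : (f : Fin n → Bool) (i : Fin n) → T (f i) → T (anyFin f)
T-anyFin⁺ f zero    t = from (T-∨ {f zero}) (inj₁ t)
T-anyFin⁺ f (suc i) t = from (T-∨ {f zero}) (inj₂ (T-anyFin⁺ (f ∘ suc) i t))

T-anyFin⁻ : (f : Fin n → Bool) → T (anyFin f) → ∃ λ i → T (f i)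
T-anyFin⁻ {suc n} f t with to (T-∨ {f zero}) t
... | inj₁ t₀ = zero , t₀
... | inj₂ t₊ with T-anyFin⁻ (f ∘ suc) t₊
...   | i , tᵢ = suc i , tᵢ

-- Opaque, so that unification never unfolds the decision procedures inside.
opaque
  subset : {P : Fin n → Set} → Decidable P → Subset n
  subset P? = tabulate (λ i → ⌊ P? i ⌋)

  ∈-subset⁺ : {P : Fin n → Set} (P? : Decidable P) {i : Fin n} → P i → i ∈ subset P?
  ∈-subset⁺ P? {i} p = ∈-tabulate⁺ (fromWitness {a? = P? i} p)

  ∈-subset⁻ : {P : Fin n → Set} (P? : Decidable P) {i : Fin n} → i ∈ subset P? → P i
  ∈-subset⁻ P? {i} i∈ = toWitness {a? = P? i} (∈-tabulate⁻ i∈)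

image : (Fin n → Fin n′) → Subset n → Subset n′
image h p = subset (λ j → any? (λ i → i ∈? p ×-dec h i ≟ j))

∈-image⁺ : {h : Fin n → Fin n′} {p : Subset n} {i : Fin n} → i ∈ p → h i ∈ image h p
∈-image⁺ {h = h} {p} {i} i∈ = ∈-subset⁺ (λ j → any? (λ i → i ∈? p ×-dec h i ≟ j)) (i , i∈ , refl)

∈-image⁻ : {h : Fin n → Fin n′} {p : Subset n} {j : Fin n′} → j ∈ image h p → ∃ λ i → i ∈ p × h i ≡ j
∈-image⁻ {h = h} {p} = ∈-subset⁻ (λ j → any? (λ i → i ∈? p ×-dec h i ≟ j))

∣image∣≡∣p∣ : (h : Fin n → Fin n′) {p : Subset n} →
  (∀ {i j} → i ∈ p → j ∈ p → h i ≡ h j → i ≡ j) → ∣ image h p ∣ ≡ ∣ p ∣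
∣image∣≡∣p∣ h inj = ≤-antisym (surjectiveOn⇒∣q∣≤∣p∣ h ∈-image⁻) (injectiveOn⇒∣p∣≤∣q∣ h ∈-image⁺ inj)

preimage : (Fin n → Fin n′) → Subset n′ → Subset n
preimage h q = subset (λ i → h i ∈? q)

∈-preimage⁺ : {h : Fin n → Fin n′} {q : Subset n′} {i : Fin n} → h i ∈ q → i ∈ preimage h q
∈-preimage⁺ {h = h} {q} = ∈-subset⁺ (λ i → h i ∈? q)

∈-preimage⁻ : {h : Fin n → Fin n′} {q : Subset n′} {i : Fin n} → i ∈ preimage h q → h i ∈ q
∈-preimage⁻ {h = h} {q} = ∈-subset⁻ (λ i → h i ∈? q)

module _ (G : Graph n) where

  ∈-N[]⁺ : {u v : Fin n} → u ≡ v ⊎ T (G u v) → v ∈ N[ G ∶ u ]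
  ∈-N[]⁺ {u} {v} = ∈-tabulate⁺ ∘ from (T-∨ {u == v}) ∘ Sum.map₁ (fromWitness {a? = u ≟ v})

  ∈-N[]⁻ : {u v : Fin n} → v ∈ N[ G ∶ u ] → u ≡ v ⊎ T (G u v)
  ∈-N[]⁻ {u} {v} = Sum.map₁ (toWitness {a? = u ≟ v}) ∘ to (T-∨ {u == v}) ∘ ∈-tabulate⁻

  ∈-NS[]⁺ : {S : Subset n} {u v : Fin n} → u ∈ S → v ∈ N[ G ∶ u ] → v ∈ NS[ G ∶ S ]
  ∈-NS[]⁺ {S} {u} u∈S v∈N[u] =
    ∈-tabulate⁺ (T-anyFin⁺ _ u (from (T-∧ {lookup S u}) (∈⇒T-lookup u∈S , ∈⇒T-lookup v∈N[u])))

  ∈-NS[]⁻ : {S : Subset n} {v : Fin n} → v ∈ NS[ G ∶ S ] → ∃ λ u → u ∈ S × v ∈ N[ G ∶ u ]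
  ∈-NS[]⁻ {S} v∈ with T-anyFin⁻ _ (∈-tabulate⁻ v∈)
  ... | u , t = u , T-lookup⇒∈ (proj₁ (to (T-∧ {lookup S u}) t)) , T-lookup⇒∈ (proj₂ (to (T-∧ {lookup S u}) t))

  ∈-propStep⁺ : ∀ {k} {P : Subset n} {u v : Fin n} →
    u ∈ P → ∣ N[ G ∶ u ] ─ P ∣ ≤ k → v ∈ N[ G ∶ u ] → v ∈ propStep k G P
  ∈-propStep⁺ {P = P} {u} u∈P few v∈N[u] =
    ∈-tabulate⁺ (T-anyFin⁺ _ u (from (T-∧ {lookup P u})
      (∈⇒T-lookup u∈P , from T-∧ (≤⇒≤ᵇ few , ∈⇒T-lookup v∈N[u]))))

  ∈-propStep⁻ : ∀ {k} {P : Subset n} {v : Fin n} → v ∈ propStep k G P →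
    ∃ λ u → u ∈ P × ∣ N[ G ∶ u ] ─ P ∣ ≤ k × v ∈ N[ G ∶ u ]
  ∈-propStep⁻ {k} {P} v∈ with T-anyFin⁻ _ (∈-tabulate⁻ v∈)
  ... | u , t with to (T-∧ {lookup P u}) t
  ...   | u∈P , t′ with to (T-∧ {∣ N[ G ∶ u ] ─ P ∣ ≤ᵇ k}) t′
  ...     | few , v∈N[u] = u , T-lookup⇒∈ u∈P , ≤ᵇ⇒≤ _ k few , T-lookup⇒∈ v∈N[u]

-- Edge contraction

module Contraction {m : ℕ} (G : Graph (suc m)) {x y : Fin (suc m)} (x≢y : x ≢ y) where

  merge : Fin (suc m) → Fin m
  merge = mergeMap x y x≢y

  lift : Fin m → Fin (suc m)
  lift = punchIn y

  z : Fin m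
  z = merge x

  merge-lift : ∀ p → merge (lift p) ≡ p
  merge-lift p with punchIn y p ≟ y
  ... | yes eq = ⊥-elim (punchInᵢ≢i y p eq)
  ... | no _   = trans (punchOut-cong y refl) (punchOut-punchIn y)

  lift-merge : ∀ {v} → v ≢ y → lift (merge v) ≡ v
  lift-merge {v} v≢y with v ≟ y
  ... | yes v≡y = ⊥-elim (v≢y v≡y)
  ... | no _    = punchIn-punchOut _

  merge-y : merge y ≡ z
  merge-y with y ≟ y | x ≟ y
  ... | no y≢y | _      = ⊥-elim (y≢y refl)
  ... | yes _  | yes eq = ⊥-elim (x≢y eq)
  ... | yes _  | no _   = punchOut-cong y refl

  merge-injective : ∀ {v w} → v ≢ y → w ≢ y → merge v ≡ merge w → v ≡ w
  merge-injective v≢y w≢y eq = trans (sym (lift-merge v≢y)) (trans (cong lift eq) (lift-merge w≢y))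

  y-or-lift : ∀ v → v ≡ y ⊎ ∃ λ s → lift s ≡ v
  y-or-lift v = Sum.map₂ (λ v≢y → merge v , lift-merge v≢y) (toSum (v ≟ y))

  merge-fibre : ∀ {v w} → w ≢ y → merge v ≡ merge w → v ≡ y ⊎ v ≡ w
  merge-fibre {v} w≢y eq = Sum.map₂ (λ v≢y → merge-injective v≢y w≢y eq) (toSum (v ≟ y))

  merge≡z⇒≡x : ∀ {v} → v ≢ y → merge v ≡ z → v ≡ x
  merge≡z⇒≡x v≢y = merge-injective v≢y x≢y

  contract⁺ : ∀ {p q u w} → p ≢ q → merge u ≡ p → merge w ≡ q → T (G u w) →
              T (contract G x y x≢y p q)
  contract⁺ {p} {q} {u} {w} p≢q refl refl uw =
    from (T-∧ {not (p == q)}) (fromWitnessFalse {a? = p ≟ q} p≢q ,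
      T-anyFin⁺ (λ u′ → anyFin (λ w′ → (merge u′ == p) ∧ (merge w′ == q) ∧ G u′ w′)) u
        (T-anyFin⁺ (λ w′ → (merge u == p) ∧ (merge w′ == q) ∧ G u w′) w (from (T-∧ {merge u == p})
        (fromWitness {a? = p ≟ p} refl , from (T-∧ {merge w == q}) (fromWitness {a? = q ≟ q} refl , uw)))))

  contract⁻ : ∀ {p q} → T (contract G x y x≢y p q) →
              ∃₂ λ u w → merge u ≡ p × merge w ≡ q × T (G u w)
  contract⁻ {p} {q} t with T-anyFin⁻ _ (proj₂ (to (T-∧ {not (p == q)}) t))
  ... | u , t′ with T-anyFin⁻ _ t′
  ...   | w , t″ with to (T-∧ {merge u == p}) t″
  ...     | u↦p , t‴ with to (T-∧ {merge w == q}) t‴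
  ...       | w↦q , uw = u , w , toWitness {a? = merge u ≟ p} u↦p , toWitness {a? = merge w ≟ q} w↦q , uw

-- Rook's graphs

record RookCoordinates (G : Graph n) (a : ℕ) : Set where
  field
    row col        : Fin n → Fin a
    vertex         : Fin a → Fin a → Fin n
    row-vertex     : ∀ i j → row (vertex i j) ≡ i
    col-vertex     : ∀ i j → col (vertex i j) ≡ j
    vertex-row-col : ∀ v → vertex (row v) (col v) ≡ v
    adjacent⇔      : ∀ {u w} → T (G u w) ⇔ (u ≢ w × (row u ≡ row w ⊎ col u ≡ col w))

  Collinear : Fin n → Fin n → Set
  Collinear u w = row u ≡ row w ⊎ col u ≡ col w

  vertex-≡ : ∀ {u w} → row u ≡ row w → col u ≡ col w → u ≡ w
  vertex-≡ {u} {w} r c = trans (sym (vertex-row-col u)) (trans (cong₂ vertex r c) (vertex-row-col w))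

transpose : {G : Graph n} {a : ℕ} → RookCoordinates G a → RookCoordinates G a
transpose coords = record
  { row            = col
  ; col            = row
  ; vertex         = λ i j → vertex j i
  ; row-vertex     = λ i j → col-vertex j i
  ; col-vertex     = λ i j → row-vertex j i
  ; vertex-row-col = vertex-row-col
  ; adjacent⇔      = mk⇔ (Product.map₂ Sum.swap ∘ to adjacent⇔) (from adjacent⇔ ∘ Product.map₂ Sum.swap)
  }
  where open RookCoordinates coords

rook-adjacency : ∀ {a} (i i′ j j′ : Fin a) →
  T (((i == i′) ∧ not (j == j′)) ∨ ((j == j′) ∧ not (i == i′))) ⇔
  ((i , j) ≢ (i′ , j′) × (i ≡ i′ ⊎ j ≡ j′))
rook-adjacency i i′ j j′ with i ≟ i′ | j ≟ j′
... | yes refl | yes refl = mk⇔ (λ ()) (λ (ne , _) → ne refl)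
... | yes refl | no j≢j′  = mk⇔ (λ _ → (j≢j′ ∘ cong proj₂) , inj₁ refl) _
... | no i≢i′  | yes refl = mk⇔ (λ _ → (i≢i′ ∘ cong proj₁) , inj₂ refl) _
... | no i≢i′  | no j≢j′  = mk⇔ (λ ()) (λ { (_ , inj₁ eq) → i≢i′ eq ; (_ , inj₂ eq) → j≢j′ eq })

KaBoxKa-coordinates : (a : ℕ) → RookCoordinates (KaBoxKa a) a
KaBoxKa-coordinates a = record
  { row            = proj₁ ∘ remQuot {a} a
  ; col            = proj₂ ∘ remQuot {a} a
  ; vertex         = combine
  ; row-vertex     = λ i j → cong proj₁ (remQuot-combine i j)
  ; col-vertex     = λ i j → cong proj₂ (remQuot-combine i j)
  ; vertex-row-col = combine-remQuot {a} a
  ; adjacent⇔      = mk⇔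
      (Product.map₁ (λ ne → ne ∘ cong (remQuot {a} a)) ∘ to (rook-adjacency _ _ _ _))
      (from (rook-adjacency _ _ _ _) ∘ Product.map₁ (λ ne → ne ∘ remQuot-injective))
  }
  where
  remQuot-injective : ∀ {u w} → remQuot {a} a u ≡ remQuot a w → u ≡ w
  remQuot-injective {u} {w} eq =
    trans (sym (combine-remQuot {a} a u)) (trans (cong (uncurry combine) eq) (combine-remQuot {a} a w))

-- Contracting an edge of a rook's graph

module ContractedRook {m d k : ℕ} {G : Graph (suc m)}
  (coords : RookCoordinates G (suc (suc (d + k))))
  {x y : Fin (suc m)} (x≢y : x ≢ y)
  (col-x≡col-y : RookCoordinates.col coords x ≡ RookCoordinates.col coords y) where

  open RookCoordinates coords
  open Contraction G x≢y

  a : ℕ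
  a = suc (suc (d + k))

  H : Graph m
  H = contract G x y x≢y

  row-x≢row-y : row x ≢ row y
  row-x≢row-y eq = x≢y (vertex-≡ eq col-x≡col-y)

  ∈-N[H]⁺ : ∀ {u w} → Collinear u w → merge w ∈ N[ H ∶ merge u ]
  ∈-N[H]⁺ {u} {w} u~w with merge u ≟ merge w
  ... | yes eq = ∈-N[]⁺ H (inj₁ eq)
  ... | no ne  = ∈-N[]⁺ H (inj₂ (contract⁺ ne refl refl (from adjacent⇔ (ne ∘ cong merge , u~w))))

  ∈-N[H]⁻ : ∀ {p q} → q ∈ N[ H ∶ p ] → ∃₂ λ u w → merge u ≡ p × merge w ≡ q × Collinear u w
  ∈-N[H]⁻ {p} {q} q∈ with ∈-N[]⁻ H {p} {q} q∈
  ... | inj₁ refl = lift p , lift p , merge-lift p , merge-lift p , inj₁ refl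
  ... | inj₂ pq with contract⁻ pq
  ...   | u , w , u↦p , w↦q , uw = u , w , u↦p , w↦q , proj₂ (to adjacent⇔ uw)

  ∈-NS[H]⁺ : ∀ {S v w} → merge v ∈ S → Collinear v w → merge w ∈ NS[ H ∶ S ]
  ∈-NS[H]⁺ v∈S v~w = ∈-NS[]⁺ H v∈S (∈-N[H]⁺ v~w)

  ∣∁p∣≥1+k : (p : Subset a) → ∣ p ∣ ≤ suc d → suc k ≤ ∣ ∁ p ∣
  ∣∁p∣≥1+k p ∣p∣≤1+d = m+∣p∣≤n⇒m≤∣∁p∣ p (≤-trans (+-monoʳ-≤ (suc k) ∣p∣≤1+d) (≤-reflexive
    (trans (cong suc (+-suc k d)) (cong (2 +_) (+-comm k d)))))

  ∣∁p-i∣≥1+k : (p : Subset a) (i : Fin a) → ∣ p ∣ ≤ d → suc k ≤ ∣ ∁ p - i ∣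
  ∣∁p-i∣≥1+k p i ∣p∣≤d = ≤-pred (≤-trans
    (m+∣p∣≤n⇒m≤∣∁p∣ p (≤-trans (+-monoʳ-≤ (suc (suc k)) ∣p∣≤d) (≤-reflexive (cong (2 +_) (+-comm k d)))))
    (∣p∣≤1+∣p-x∣ (∁ p) i))

  module LowerBound (S : Subset m) (∣S∣≤d : ∣ S ∣ ≤ d) where

    occupied : (Fin (suc m) → Fin a) → Subset a
    occupied h = image h (preimage merge S)

    occupiedRows occupiedCols : Subset a
    occupiedRows = occupied row
    occupiedCols = occupied col

    occupied⁺ : ∀ h {v} → merge v ∈ S → h v ∈ occupied h
    occupied⁺ h v∈S = ∈-image⁺ {h = h} (∈-preimage⁺ {h = merge} v∈S)

    occupied⁻ : ∀ h {i} → i ∈ occupied h → ∃ λ v → merge v ∈ S × h v ≡ i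
    occupied⁻ h i∈ with ∈-image⁻ {h = h} i∈
    ... | v , v∈ , hv≡i = v , ∈-preimage⁻ {h = merge} v∈ , hv≡i

    ∣occupiedCols∣≤d : ∣ occupiedCols ∣ ≤ d
    ∣occupiedCols∣≤d = ≤-trans (surjectiveOn⇒∣q∣≤∣p∣ (col ∘ lift) cover) ∣S∣≤d
      where
      cover : ∀ {j} → j ∈ occupiedCols → ∃ λ s → s ∈ S × col (lift s) ≡ j
      cover j∈ with occupied⁻ col j∈
      ... | v , v∈S , refl with y-or-lift v
      ...   | inj₁ v≡y      = z , subst (_∈ S) (trans (cong merge v≡y) merge-y) v∈S ,
                              trans (cong col (lift-merge x≢y)) (trans col-x≡col-y (cong col (sym v≡y)))
      ...   | inj₂ (s , refl) = s , subst (_∈ S) (merge-lift s) v∈S , refl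

    -- z occupies the rows of both x and y.
    ∣occupiedRows∣≤1+d : ∣ occupiedRows ∣ ≤ suc d
    ∣occupiedRows∣≤1+d = ≤-trans (∣p∣≤1+∣p-x∣ occupiedRows (row y))
      (s≤s (≤-trans (surjectiveOn⇒∣q∣≤∣p∣ (row ∘ lift) cover) ∣S∣≤d))
      where
      cover : ∀ {i} → i ∈ occupiedRows - row y → ∃ λ s → s ∈ S × row (lift s) ≡ i
      cover i∈ with occupied⁻ row (p─q⊆p occupiedRows _ i∈)
      ... | v , v∈S , refl with y-or-lift v
      ...   | inj₁ v≡y      = ⊥-elim (x∈p-y⇒x≢y i∈ (cong row v≡y))
      ...   | inj₂ (s , refl) = s , subst (_∈ S) (merge-lift s) v∈S , refl

    col-x∉⇒∣occupiedRows∣≤d : col x ∉ occupiedCols → ∣ occupiedRows ∣ ≤ d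
    col-x∉⇒∣occupiedRows∣≤d cx∉ = ≤-trans (surjectiveOn⇒∣q∣≤∣p∣ (row ∘ lift) cover) ∣S∣≤d
      where
      cover : ∀ {i} → i ∈ occupiedRows → ∃ λ s → s ∈ S × row (lift s) ≡ i
      cover i∈ with occupied⁻ row i∈
      ... | v , v∈S , refl with y-or-lift v
      ...   | inj₁ v≡y      = ⊥-elim (cx∉ (subst (_∈ occupiedCols)
                                (trans (cong col v≡y) (sym col-x≡col-y)) (occupied⁺ col v∈S)))
      ...   | inj₂ (s , refl) = s , subst (_∈ S) (merge-lift s) v∈S , refl

    Free : Fin (suc m) → Set
    Free v = row v ∉ occupiedRows × col v ∉ occupiedCols

    Hidden : Fin m → Set
    Hidden q = ∀ {v} → merge v ≡ q → Free v

    Visible : Subset m → Set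
    Visible P = ∀ {q} → q ∈ P → ¬ Hidden q

    occupied⇒¬free : ∀ {v w} → merge v ∈ S → Collinear v w → ¬ Free w
    occupied⇒¬free v∈S (inj₁ r) (r∉ , _) = r∉ (subst (_∈ occupiedRows) r (occupied⁺ row v∈S))
    occupied⇒¬free v∈S (inj₂ c) (_ , c∉) = c∉ (subst (_∈ occupiedCols) c (occupied⁺ col v∈S))

    free⇒hidden : ∀ {v} → Free v → v ≢ y → (v ≡ x → Free y) → Hidden (merge v)
    free⇒hidden {v} free v≢y free-y {v′} v′↦ with merge-fibre {v′} {v} v≢y v′↦
    ... | inj₂ refl  = free
    ... | inj₁ v′≡y = subst Free (sym v′≡y)
                        (free-y (merge≡z⇒≡x v≢y (trans (sym v′↦) (trans (cong merge v′≡y) merge-y))))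

    record HiddenLine (u : Fin (suc m)) : Set where
      field
        indices         : Subset a
        many            : suc k ≤ ∣ indices ∣
        point           : Fin a → Fin (suc m)
        point-injective : ∀ {i j} → point i ≡ point j → i ≡ j
        collinear       : ∀ {i} → i ∈ indices → Collinear u (point i)
        free            : ∀ {i} → i ∈ indices → Free (point i)
        point≢y         : ∀ {i} → i ∈ indices → point i ≢ y
        point≡x⇒free-y  : ∀ {i} → i ∈ indices → point i ≡ x → Free y

      hidden : ∀ {i} → i ∈ indices → Hidden (merge (point i))
      hidden i∈ = free⇒hidden (free i∈) (point≢y i∈) (point≡x⇒free-y i∈)

      some-hidden : ∃ Hidden
      some-hidden with ∣p∣>0⇒Nonempty indices (≤-trans (s≤s z≤n) many)
      ... | i , i∈ = merge (point i) , hidden i∈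

      unseen : ∀ {P} → Visible P → suc k ≤ ∣ N[ H ∶ merge u ] ─ P ∣
      unseen visible = ≤-trans many (injectiveOn⇒∣p∣≤∣q∣ (merge ∘ point)
        (λ i∈ → x∈p∧x∉q⇒x∈p─q (∈-N[H]⁺ (collinear i∈)) (λ i∈P → visible i∈P (hidden i∈)))
        (λ i∈ j∈ eq → point-injective (merge-injective (point≢y i∈) (point≢y j∈) eq)))

    rowLine : ∀ {u i} → i ∉ occupiedRows → row u ≡ i → HiddenLine u
    rowLine {u} {i} i∉ row-u≡i = record
      { indices         = ∁ occupiedCols - col x
      ; many            = ∣∁p-i∣≥1+k occupiedCols (col x) ∣occupiedCols∣≤d
      ; point           = vertex i
      ; point-injective = λ eq → trans (sym (col-vertex _ _)) (trans (cong col eq) (col-vertex _ _))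
      ; collinear       = λ _ → inj₁ (trans row-u≡i (sym (row-vertex _ _)))
      ; free            = λ j∈ → subst (_∉ occupiedRows) (sym (row-vertex _ _)) i∉ ,
                                 subst (_∉ occupiedCols) (sym (col-vertex _ _)) (x∈∁p⇒x∉p (p─q⊆p _ _ j∈))
      ; point≢y         = λ j∈ eq → x∈p-y⇒x≢y j∈ (trans (sym (col-vertex _ _)) (trans (cong col eq) (sym col-x≡col-y)))
      ; point≡x⇒free-y  = λ j∈ eq → ⊥-elim (x∈p-y⇒x≢y j∈ (trans (sym (col-vertex _ _)) (cong col eq)))
      }

    columnLine : ∀ {u j} → j ∉ occupiedCols → col u ≡ j →
      (I : Subset a) → I ⊆ ∁ occupiedRows → suc k ≤ ∣ I ∣ →
      (∀ {i} → i ∈ I → vertex i j ≢ y) → (∀ {i} → i ∈ I → vertex i j ≡ x → Free y) →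
      HiddenLine u
    columnLine {u} {j} j∉ col-u≡j I I⊆ many point≢y point≡x⇒free-y = record
      { indices         = I
      ; many            = many
      ; point           = λ i → vertex i j
      ; point-injective = λ eq → trans (sym (row-vertex _ _)) (trans (cong row eq) (row-vertex _ _))
      ; collinear       = λ _ → inj₂ (trans col-u≡j (sym (col-vertex _ _)))
      ; free            = λ i∈ → subst (_∉ occupiedRows) (sym (row-vertex _ _)) (x∈∁p⇒x∉p (I⊆ i∈)) ,
                                 subst (_∉ occupiedCols) (sym (col-vertex _ _)) j∉
      ; point≢y         = point≢y
      ; point≡x⇒free-y  = point≡x⇒free-y
      }

    columnLine-off-x : ∀ {u j} → j ∉ occupiedCols → col u ≡ j → j ≢ col x → HiddenLine u
    columnLine-off-x j∉ col-u≡j j≢cx =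
      columnLine j∉ col-u≡j (∁ occupiedRows) id (∣∁p∣≥1+k occupiedRows ∣occupiedRows∣≤1+d)
        (λ _ eq → j≢cx (trans (sym (col-vertex _ _)) (trans (cong col eq) (sym col-x≡col-y))))
        (λ _ eq → ⊥-elim (j≢cx (trans (sym (col-vertex _ _)) (cong col eq))))

    -- x and y share the image z, which is hidden only if both are free:
    -- drop the row of y if it is unoccupied, and otherwise that of x.
    columnLine-x : ∀ {u} → col x ∉ occupiedCols → col u ≡ col x → HiddenLine u
    columnLine-x cx∉ col-u≡cx with row y ∈? occupiedRows
    ... | yes ry∈ = columnLine cx∉ col-u≡cx (∁ occupiedRows - row x) (p─q⊆p _ _)
      (∣∁p-i∣≥1+k occupiedRows (row x) (col-x∉⇒∣occupiedRows∣≤d cx∉))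
      (λ i∈ eq → x∈∁p⇒x∉p (p─q⊆p _ _ i∈) (subst (_∈ occupiedRows) (trans (cong row (sym eq)) (row-vertex _ _)) ry∈))
      (λ i∈ eq → ⊥-elim (x∈p-y⇒x≢y i∈ (trans (sym (row-vertex _ _)) (cong row eq))))
    ... | no ry∉ = columnLine cx∉ col-u≡cx (∁ occupiedRows - row y) (p─q⊆p _ _)
      (∣∁p-i∣≥1+k occupiedRows (row y) (col-x∉⇒∣occupiedRows∣≤d cx∉))
      (λ i∈ eq → x∈p-y⇒x≢y i∈ (trans (sym (row-vertex _ _)) (cong row eq)))
      (λ _ _ → ry∉ , subst (_∉ occupiedCols) col-x≡col-y cx∉)

    line : ∀ {u w} → Free w → Collinear u w → HiddenLine u
    line (r∉ , _) (inj₁ r≡) = rowLine r∉ r≡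
    line {w = w} (_ , c∉) (inj₂ c≡) with col w ≟ col x
    ... | no cw≢cx  = columnLine-off-x c∉ c≡ cw≢cx
    ... | yes cw≡cx = columnLine-x (subst (_∉ occupiedCols) cw≡cx c∉) (trans c≡ cw≡cx)

    visible-NS : Visible NS[ H ∶ S ]
    visible-NS q∈ hidden with ∈-NS[]⁻ H q∈
    ... | p , p∈S , q∈N[p] with ∈-N[H]⁻ q∈N[p]
    ...   | u , w , u↦p , w↦q , u~w = occupied⇒¬free (subst (_∈ S) (sym u↦p) p∈S) u~w (hidden w↦q)

    visible-propStep : ∀ {P} → Visible P → Visible (propStep k H P)
    visible-propStep {P} visible {q} q∈ hidden =
      let p , _ , few , q∈N[p]    = ∈-propStep⁻ H {k} {P} q∈
          u , w , u↦p , w↦q , u~w = ∈-N[H]⁻ {p} {q} q∈N[p]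
      in <⇒≱ (subst (λ p → suc k ≤ ∣ N[ H ∶ p ] ─ P ∣) u↦p (HiddenLine.unseen (line (hidden w↦q) u~w) visible)) few

    visible-P^ : ∀ t → Visible ((P[ H , k ]^ S) t)
    visible-P^ zero    = visible-NS
    visible-P^ (suc t) = visible-propStep {(P[ H , k ]^ S) t} (visible-P^ t)

    hidden-vertex : ∃ Hidden
    hidden-vertex =
      let i , i∈ = ∣p∣>0⇒Nonempty (∁ occupiedRows) (≤-trans (s≤s z≤n) (∣∁p∣≥1+k occupiedRows ∣occupiedRows∣≤1+d))
      in HiddenLine.some-hidden (rowLine {u = vertex i zero} (x∈∁p⇒x∉p {p = occupiedRows} i∈) (row-vertex i zero))

    not-dominating : ¬ IsKPowerDom k H S
    not-dominating dominating =
      let q , hidden = hidden-vertex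
          t , q∈     = dominating q
      in visible-P^ t q∈ hidden

  module UpperBound where

    other : Fin (d + k) → Fin a
    other τ = punchIn (row x) (punchIn (punchOut row-x≢row-y) τ)

    other≢row-x : ∀ τ → other τ ≢ row x
    other≢row-x τ = punchInᵢ≢i (row x) _

    other≢row-y : ∀ τ → other τ ≢ row y
    other≢row-y τ eq = punchInᵢ≢i (punchOut row-x≢row-y) τ
      (punchIn-injective (row x) _ _ (trans eq (sym (punchIn-punchOut row-x≢row-y))))

    other-injective : ∀ {τ τ′} → other τ ≡ other τ′ → τ ≡ τ′
    other-injective eq = punchIn-injective _ _ _ (punchIn-injective (row x) _ _ eq)

    other-cases : ∀ ρ → ρ ≡ row x ⊎ ρ ≡ row y ⊎ ∃ λ τ → other τ ≡ ρ
    other-cases ρ with ρ ≟ row x | ρ ≟ row y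
    ... | yes ρ≡rx | _        = inj₁ ρ≡rx
    ... | no _     | yes ρ≡ry = inj₂ (inj₁ ρ≡ry)
    ... | no ρ≢rx  | no ρ≢ry  = inj₂ (inj₂ (punchOut ρ′≢ry′ ,
      trans (cong (punchIn (row x)) (punchIn-punchOut ρ′≢ry′)) (punchIn-punchOut (ρ≢rx ∘ sym))))
      where
      ρ′≢ry′ : punchOut row-x≢row-y ≢ punchOut (ρ≢rx ∘ sym)
      ρ′≢ry′ eq = ρ≢ry (sym (punchOut-injective row-x≢row-y (ρ≢rx ∘ sym) eq))

    chosen : Fin d → Fin a
    chosen t = other (t ↑ˡ k)

    spare : Fin k → Fin a
    spare t = other (d ↑ʳ t)

    row-cases : ∀ ρ → ρ ≡ row x ⊎ ρ ≡ row y ⊎ (∃ λ t → chosen t ≡ ρ) ⊎ (∃ λ t → spare t ≡ ρ)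
    row-cases ρ with other-cases ρ
    ... | inj₁ ρ≡rx              = inj₁ ρ≡rx
    ... | inj₂ (inj₁ ρ≡ry)       = inj₂ (inj₁ ρ≡ry)
    ... | inj₂ (inj₂ (τ , refl)) with splitAt d τ in eq
    ...   | inj₁ t = inj₂ (inj₂ (inj₁ (t , cong other (splitAt⁻¹-↑ˡ eq))))
    ...   | inj₂ t = inj₂ (inj₂ (inj₂ (t , cong other (splitAt⁻¹-↑ʳ eq))))

    source : Fin (suc d) → Fin (suc m)
    source zero    = x
    source (suc t) = vertex (chosen t) (col x)

    row-source-injective : ∀ {s s′} → row (source s) ≡ row (source s′) → s ≡ s′
    row-source-injective {zero}  {zero}   _  = refl
    row-source-injective {zero}  {suc t}  eq = ⊥-elim (other≢row-x _ (trans (sym (row-vertex _ _)) (sym eq)))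
    row-source-injective {suc t} {zero}   eq = ⊥-elim (other≢row-x _ (trans (sym (row-vertex _ _)) eq))
    row-source-injective {suc t} {suc t′} eq =
      cong suc (↑ˡ-injective k t t′ (other-injective (trans (sym (row-vertex _ _)) (trans eq (row-vertex _ _)))))

    source≢y : ∀ s → source s ≢ y
    source≢y zero    = x≢y
    source≢y (suc t) eq = other≢row-y _ (trans (sym (row-vertex _ _)) (cong row eq))

    S₀ : Subset m
    S₀ = image (merge ∘ source) ⊤

    ∣S₀∣≡1+d : ∣ S₀ ∣ ≡ suc d
    ∣S₀∣≡1+d = trans (∣image∣≡∣p∣ (merge ∘ source) λ {s} {s′} _ _ eq →
                 row-source-injective (cong row (merge-injective (source≢y s) (source≢y s′) eq)))
               (∣⊤∣≡n (suc d))

    source∈S₀ : ∀ s → merge (source s) ∈ S₀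
    source∈S₀ s = ∈-image⁺ {h = merge ∘ source} {p = ⊤} {i = s} ∈⊤

    Seen : Fin (suc m) → Set
    Seen w = merge w ∈ NS[ H ∶ S₀ ]

    seen-row-x : ∀ {w} → row w ≡ row x → Seen w
    seen-row-x r = ∈-NS[H]⁺ (source∈S₀ zero) (inj₁ (sym r))

    seen-row-y : ∀ {w} → row w ≡ row y → Seen w
    seen-row-y r = ∈-NS[H]⁺ (subst (_∈ S₀) (sym merge-y) (source∈S₀ zero)) (inj₁ (sym r))

    seen-chosen : ∀ {w t} → chosen t ≡ row w → Seen w
    seen-chosen {t = t} r = ∈-NS[H]⁺ (source∈S₀ (suc t)) (inj₁ (trans (row-vertex _ _) r))

    seen-col-x : ∀ {w} → col w ≡ col x → Seen w
    seen-col-x c = ∈-NS[H]⁺ (source∈S₀ zero) (inj₂ (sym c))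

    collinear-y⇒seen : ∀ {w} → Collinear y w → Seen w
    collinear-y⇒seen (inj₁ r) = seen-row-y (sym r)
    collinear-y⇒seen (inj₂ c) = seen-col-x (trans (sym c) (sym col-x≡col-y))

    unseen-in-spare-row : ∀ {j w} → Collinear (vertex (row x) j) w → ¬ Seen w → ∃ λ t → vertex (spare t) j ≡ w
    unseen-in-spare-row (inj₁ r) unseen = ⊥-elim (unseen (seen-row-x (trans (sym r) (row-vertex _ _))))
    unseen-in-spare-row {j} {w} (inj₂ c) unseen with row-cases (row w)
    ... | inj₁ r                       = ⊥-elim (unseen (seen-row-x r))
    ... | inj₂ (inj₁ r)                = ⊥-elim (unseen (seen-row-y r))
    ... | inj₂ (inj₂ (inj₁ (t , r)))   = ⊥-elim (unseen (seen-chosen r))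
    ... | inj₂ (inj₂ (inj₂ (t , r)))   = t , vertex-≡ (trans (row-vertex _ _) r) (trans (col-vertex _ _) (trans (sym (col-vertex _ _)) c))

    few-unseen : ∀ j → ∣ N[ H ∶ merge (vertex (row x) j) ] ─ NS[ H ∶ S₀ ] ∣ ≤ k
    few-unseen j = ≤-trans (surjectiveOn⇒∣q∣≤∣p∣ {p = ⊤} (λ t → merge (vertex (spare t) j)) cover) (≤-reflexive (∣⊤∣≡n k))
      where
      u = vertex (row x) j

      u≢y : u ≢ y
      u≢y eq = row-x≢row-y (trans (sym (row-vertex _ _)) (cong row eq))

      cover : ∀ {q} → q ∈ N[ H ∶ merge u ] ─ NS[ H ∶ S₀ ] → ∃ λ t → t ∈ ⊤ × merge (vertex (spare t) j) ≡ q
      cover {q} q∈ =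
        let u′ , w , u′↦ , w↦q , u′~w = ∈-N[H]⁻ {merge u} {q} (p─q⊆p N[ H ∶ merge u ] NS[ H ∶ S₀ ] q∈)
            unseen : ¬ Seen w
            unseen seen = x∈p─q⇒x∉q N[ H ∶ merge u ] NS[ H ∶ S₀ ] q∈ (subst (_∈ NS[ H ∶ S₀ ]) w↦q seen)
        in case merge-fibre u≢y u′↦ of λ where
             (inj₁ u′≡y) → ⊥-elim (unseen (collinear-y⇒seen (subst (λ v → Collinear v w) u′≡y u′~w)))
             (inj₂ u′≡u) → let t , spare-t≡w = unseen-in-spare-row (subst (λ v → Collinear v w) u′≡u u′~w) unseen
                            in t , ∈⊤ , trans (cong merge spare-t≡w) w↦q

    dominates : IsKPowerDom k H S₀
    dominates q = 1 , subst (_∈ propStep k H NS[ H ∶ S₀ ]) (merge-lift q)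
      (∈-propStep⁺ H {k} {NS[ H ∶ S₀ ]} (seen-row-x (row-vertex _ _)) (few-unseen (col (lift q)))
        (∈-N[H]⁺ {vertex (row x) (col (lift q))} {lift q} (inj₂ (col-vertex _ _))))

  γ≡1+d : γPk≡ k H (suc d)
  γ≡1+d = (S₀ , dominates , ∣S₀∣≡1+d) , λ S dominating →
    ≮⇒≥ λ ∣S∣<1+d → LowerBound.not-dominating S (≤-pred ∣S∣<1+d) dominating
    where open UpperBound

γ-contract-rook : ∀ {m d k} {G : Graph (suc m)} → RookCoordinates G (suc (suc (d + k))) →
  ∀ {x y} (x≢y : x ≢ y) → T (G x y) → γPk≡ k (contract G x y x≢y) (suc d)
γ-contract-rook coords x≢y xy with proj₂ (to (RookCoordinates.adjacent⇔ coords) xy)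
... | inj₁ same-row = ContractedRook.γ≡1+d (transpose coords) x≢y same-row
... | inj₂ same-col = ContractedRook.γ≡1+d coords x≢y same-col

k+2≤a⇒a≡2+d+k : ∀ {k a} → k + 2 ≤ a → ∃ λ d → a ≡ suc (suc (d + k))
k+2≤a⇒a≡2+d+k {k} {a} k+2≤a with m≤n⇒∃[o]m+o≡n k+2≤a
... | d , k+2+d≡a = d , (begin
  a                  ≡⟨ sym k+2+d≡a ⟩
  k + 2 + d          ≡⟨ cong (_+ d) (+-comm k 2) ⟩
  suc (suc (k + d))  ≡⟨ cong (2 +_) (+-comm k d) ⟩
  suc (suc (d + k))  ∎)
  where open ≡-Reasoning

-- The argument never uses 1 ≤ k: the formula holds for k = 0 as well.
mainTheorem9 : (k a : ℕ) → 1 ≤ k → k + 2 ≤ a →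
    (x y : Fin (a * a)) → (x≢y : x ≢ y) → KaBoxKa a x y ≡ true →
    γPk≡ k (contract (KaBoxKa a) x y x≢y) (a ∸ k ∸ 1)
mainTheorem9 k a _ k+2≤a x y x≢y xy with k+2≤a⇒a≡2+d+k k+2≤a
... | d , refl = subst (γPk≡ k (contract (KaBoxKa a) x y x≢y)) (sym (cong (_∸ 1) (m+n∸n≡m (suc (suc d)) k)))
                   (γ-contract-rook (KaBoxKa-coordinates a) x≢y (from T-≡ xy))
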